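{- Let $m>1$ be odd and let $\varphi:\mathbb{Z}_{2m}\to\{\pm1\}$ be a binary sequence of length $2m$. Define $\phi:\mathbb{Z}_2\times\mathbb{Z}_m\to\{\pm1\}$ as follows, where $a\in\{0,1\}$, $k\in\{0,1,\dots,m-1\}$ and indices of $\varphi$ are read modulo $2m$. If $m\equiv1\bmod4$: $\phi(a,k)=\varphi(k+am)$ if $k\equiv0\bmod4$; $\phi(a,k)=(-1)^{1-a}\varphi(k+(1-a)m)$ if $k\equiv1\bmod4$; $\phi(a,k)=-\varphi(k+am)$ if $k\equiv2\bmod4$; $\phi(a,k)=(-1)^a\varphi(k+(1-a)m)$ if $k\equiv3\bmod4$. If $m\equiv3\bmod4$: $\phi(a,k)=(-1)^a\varphi(k+am)$ if $k\equiv0\bmod4$; $\phi(a,k)=\varphi(k+(1-a)m)$ if $k\equiv1\bmod4$; $\phi(a,k)=(-1)^{1-a}\varphi(k+am)$ if $k\equiv2\bmod4$; $\phi(a,k)=-\varphi(k+(1-a)m)$ if $k\equiv3\bmod4$. Then $\varphi$ is a GOBS if and only if $\phi$ is a GOBA$(2,m)$ of type $(1,0)$.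
   Context: For a map $\theta:A\to\mathbb{C}$ on a finite abelian group $A$, $R_\theta(x)=\sum_{b\in A}\theta(b)\overline{\theta(x+b)}$. For a binary sequence $\varphi$ of length $2m$, its expansion is $\varphi':\mathbb{Z}_{4m}\to\{\pm1\}$ with $\varphi'(x)=\varphi(x)$ for $0\le x<2m$ and $\varphi'(x)=-\varphi(x-2m)$ for $2m\le x<4m$; $\varphi$ is a GOBS (generalized optimal binary sequence) if $R_{\varphi'}(x)\in\{0,\pm4\}$ for all $x\in\mathbb{Z}_{4m}\setminus\{0,2m\}$ and the number of $x\in\mathbb{Z}_{4m}$ with $R_{\varphi'}(x)=0$ is $2m$. For a binary array $\phi:\mathbb{Z}_2\times\mathbb{Z}_m\to\{\pm1\}$, its expansion w.r.t. type $(1,0)$ is $\phi':\mathbb{Z}_4\times\mathbb{Z}_m\to\{\pm1\}$ with $\phi'(a,k)=\phi(a,k)$ for $a\in\{0,1\}$ and $\phi'(a,k)=-\phi(a-2,k)$ for $a\in\{2,3\}$; $\phi$ is a GOBA$(2,m)$ of type $(1,0)$ if $R_{\phi'}(x)\in\{0,\pm4\}$ for all $x\in(\mathbb{Z}_4\times\mathbb{Z}_m)\setminus\{(0,0),(2,0)\}$ and the number of $x$ with $R_{\phi'}(x)=0$ is $2m$. -}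

module Defs where

open import Data.Nat as ℕ using (ℕ; zero; suc; _+_; _*_; _∸_; _<_; _%_; _<ᵇ_; _≡ᵇ_)
open import Data.Nat.DivMod using (_mod_)
open import Data.Fin using (Fin; toℕ)
open import Data.Bool using (Bool; true; false; if_then_else_)
open import Data.Integer as ℤ using (ℤ)
open import Data.Sign as Sign using (Sign)
open import Data.Sum using (_⊎_)
open import Data.Product using (_×_)
open import Relation.Binary.PropositionalEquality using (_≡_; _≢_)
open import Relation.Nullary using (¬_)

-- ±1 values are modelled by Sign (+ ↦ 1, - ↦ -1).
sgn : Sign → ℤ
sgn Sign.+ = ℤ.+ 1
sgn Sign.- = ℤ.-[1+ 0 ]

modN : ℕ → ℕ → ℕ
modN x zero = x
modN x (suc n) = x % suc n

-- Read a length-n sequence at an index taken modulo n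
-- (default + for n = 0, which never occurs below).
atS : {n : ℕ} → (Fin n → Sign) → ℕ → Sign
atS {zero} f i = Sign.+
atS {suc n} f i = f (i mod suc n)

Σ< : ℕ → (ℕ → ℤ) → ℤ
Σ< zero f = ℤ.+ 0
Σ< (suc n) f = Σ< n f ℤ.+ f n

count< : ℕ → (ℕ → Bool) → ℕ
count< zero p = 0
count< (suc n) p = (if p n then 1 else 0) + count< n p

isZero : ℤ → Bool
isZero (ℤ.+ zero) = true
isZero _ = false

In0±4 : ℤ → Set
In0±4 r = r ≡ ℤ.+ 0 ⊎ r ≡ ℤ.+ 4 ⊎ r ≡ ℤ.-[1+ 3 ]

-- expansion φ' : Z_{4m} → {±1}, elements of Z_{4m} are 0 ≤ x < 4m
seqExp : (m : ℕ) → (Fin (2 * m) → Sign) → ℕ → ℤ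
seqExp m φ x = if x <ᵇ 2 * m then sgn (atS φ x) else ℤ.- sgn (atS φ (x ∸ 2 * m))

-- R_{φ'}(x) = Σ_{b ∈ Z_{4m}} φ'(b) φ'(x+b)   (values are real, so no conjugate)
seqAC : (m : ℕ) → (Fin (2 * m) → Sign) → ℕ → ℤ
seqAC m φ x = Σ< (4 * m) (λ b → seqExp m φ b ℤ.* seqExp m φ (modN (x + b) (4 * m)))

IsGOBS : (m : ℕ) → (Fin (2 * m) → Sign) → Set
IsGOBS m φ =
  (∀ x → x < 4 * m → x ≢ 0 → x ≢ 2 * m → In0±4 (seqAC m φ x))
  × count< (4 * m) (λ x → isZero (seqAC m φ x)) ≡ 2 * m

-- expansion w.r.t. type (1,0): φ' : Z_4 × Z_m → {±1}, elements (a,k), a < 4, k < m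
arrExp : (m : ℕ) → (Fin 2 → Fin m → Sign) → ℕ → ℕ → ℤ
arrExp m ψ a k =
  if a <ᵇ 2 then sgn (atS (ψ (a mod 2)) k) else ℤ.- sgn (atS (ψ ((a ∸ 2) mod 2)) k)

arrAC : (m : ℕ) → (Fin 2 → Fin m → Sign) → ℕ → ℕ → ℤ
arrAC m ψ x₁ x₂ =
  Σ< 4 (λ b₁ → Σ< m (λ b₂ →
    arrExp m ψ b₁ b₂ ℤ.* arrExp m ψ ((x₁ + b₁) % 4) (modN (x₂ + b₂) m)))

IsGOBA-10 : (m : ℕ) → (Fin 2 → Fin m → Sign) → Set
IsGOBA-10 m ψ =
  (∀ x₁ x₂ → x₁ < 4 → x₂ < m → ¬ ((x₁ ≡ 0 ⊎ x₁ ≡ 2) × x₂ ≡ 0) → In0±4 (arrAC m ψ x₁ x₂))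
  × sumCounts ≡ 2 * m
  where
  sumCounts : ℕ
  sumCounts = go 4
    where
    go : ℕ → ℕ
    go zero = 0
    go (suc i) = count< m (λ x₂ → isZero (arrAC m ψ i x₂)) + go i

neg1^ : ℕ → Sign
neg1^ zero = Sign.+
neg1^ (suc _) = Sign.-

construct : (m : ℕ) → (Fin (2 * m) → Sign) → Fin 2 → Fin m → Sign
construct m φ a' k' =
  if m % 4 ≡ᵇ 1 then case1 (k % 4) else case3 (k % 4)
  where
  a = toℕ a'
  k = toℕ k'
  same = atS φ (k + a * m)
  other = atS φ (k + (1 ∸ a) * m)
  case1 : ℕ → Sign
  case1 0 = same
  case1 1 = neg1^ (1 ∸ a) Sign.* other
  case1 2 = Sign.opposite same
  case1 _ = neg1^ a Sign.* other
  case3 : ℕ → Sign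
  case3 0 = neg1^ a Sign.* same
  case3 1 = other
  case3 2 = neg1^ (1 ∸ a) Sign.* same
  case3 _ = Sign.opposite other

module Submission where

-- For odd m the map x ↦ (x mod 4, x mod m) is a group isomorphism ℤ₄ₘ ≅ ℤ₄ × ℤₘ, and the
-- construction is designed so that it carries the expansion φ' of φ onto the expansion ϕ'
-- of the array: φ'(x) = ϕ'(x mod 4, x mod m).  Autocorrelations are preserved by the
-- isomorphism, R_φ'(x) = R_ϕ'(x mod 4, x mod m), the excluded shifts 0 and 2m correspond to
-- (0,0) and (2,0), and the numbers of zero autocorrelations agree.  Sums over ℤ₄ₘ are
-- regrouped into m blocks of 4, on each of which j ↦ (s + j m) mod 4 permutes ℤ₄.

open import Defs
open import Algebra.Bundles using (CommutativeMonoid)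
import Algebra.Properties.CommutativeSemigroup as CommSemigroupProps
import Algebra.Solver.CommutativeMonoid as CommMonoidSolver
open import Data.Bool using (Bool; true; false; if_then_else_; T)
open import Data.Empty using (⊥-elim)
open import Data.Fin using (Fin; toℕ; #_)
import Data.Fin.Properties as FinP
open import Data.Integer as ℤ using (ℤ)
import Data.Integer.Properties as ℤP
open import Data.Nat
  using (ℕ; zero; suc; _+_; _*_; _∸_; _<_; _≤_; _%_; _/_; _<ᵇ_; _≡ᵇ_; z≤n; s≤s; NonZero)
import Data.Nat.Properties as ℕP
open import Data.Nat.DivMod
open import Data.Nat.Divisibility using (divides)
open import Data.Product using (_×_; _,_; proj₁; proj₂; ∃)
open import Data.Sign as Sign using (Sign)
import Data.Sign.Properties as SignP
open import Data.Sum using (_⊎_; inj₁; inj₂; [_,_])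
open import Data.Unit using (tt)
open import Data.Vec using (Vec; _∷_; [])
open import Function.Bundles using (_⇔_; mk⇔)
open import Level using (_⊔_)
open import Relation.Binary.PropositionalEquality hiding ([_])
open import Relation.Nullary using (¬_)

<4-elim : ∀ {p} {P : ℕ → Set p} → P 0 → P 1 → P 2 → P 3 → ∀ j → j < 4 → P j
<4-elim p₀ _ _ _ 0 _ = p₀
<4-elim _ p₁ _ _ 1 _ = p₁
<4-elim _ _ p₂ _ 2 _ = p₂
<4-elim _ _ _ p₃ 3 _ = p₃
<4-elim _ _ _ _ (suc (suc (suc (suc _)))) (s≤s (s≤s (s≤s (s≤s ()))))

odd⇒%4≡1⊎3 : ∀ {m} → m % 2 ≡ 1 → m % 4 ≡ 1 ⊎ m % 4 ≡ 3
odd⇒%4≡1⊎3 {m} odd = <4-elim {P = λ r → r % 2 ≡ 1 → r ≡ 1 ⊎ r ≡ 3}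
  (λ ()) (λ _ → inj₁ refl) (λ ()) (λ _ → inj₂ refl)
  (m % 4) (m%n<n m 4) (trans (m∣n⇒o%n%m≡o%m 2 4 m (divides 2 refl)) odd)

[s+jm]%4 : ∀ s j m → (s + j * m) % 4 ≡ (s % 4 + j * (m % 4)) % 4
[s+jm]%4 s j m = begin
  (s + j * m) % 4                         ≡⟨ %-distribˡ-+ s (j * m) 4 ⟩
  (s % 4 + (j * m) % 4) % 4               ≡⟨ cong₂ (λ a b → (a + b) % 4) (sym (m%n%n≡m%n s 4)) jm%4 ⟩
  (s % 4 % 4 + (j * (m % 4)) % 4) % 4     ≡⟨ %-distribˡ-+ (s % 4) (j * (m % 4)) 4 ⟨
  (s % 4 + j * (m % 4)) % 4               ∎
  where
  open ≡-Reasoning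
  jm%4 : (j * m) % 4 ≡ (j * (m % 4)) % 4
  jm%4 = begin
    (j * m) % 4                   ≡⟨ %-distribˡ-* j m 4 ⟩
    (j % 4 * (m % 4)) % 4         ≡⟨ cong (λ z → (j % 4 * z) % 4) (m%n%n≡m%n m 4) ⟨
    (j % 4 * (m % 4 % 4)) % 4     ≡⟨ %-distribˡ-* j (m % 4) 4 ⟨
    (j * (m % 4)) % 4             ∎

[s+jm]%m≡s : ∀ {s m} .{{_ : NonZero m}} j → s < m → (s + j * m) % m ≡ s
[s+jm]%m≡s {s} {m} j s<m = trans ([m+kn]%n≡m%n s j m) (m<n⇒m%n≡m s<m)

s+j*m<k*m : ∀ {s j m k} → s < m → j < k → s + j * m < k * m
s+j*m<k*m {s} {j} {m} s<m j<k = ℕP.≤-trans (ℕP.+-monoˡ-< (j * m) s<m) (ℕP.*-monoˡ-≤ m j<k)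

[2m]%4≡2 : ∀ {m} → m % 2 ≡ 1 → (2 * m) % 4 ≡ 2
[2m]%4≡2 {m} odd = begin
  (2 * m) % 4    ≡⟨ cong (_% 4) (ℕP.*-comm 2 m) ⟩
  (m * 2) % 4    ≡⟨ m%n*o≡m*o%[n*o] m 2 2 ⟨
  m % 2 * 2      ≡⟨ cong (_* 2) odd ⟩
  2              ∎
  where open ≡-Reasoning

-- u² ≡ 1 (mod 4) for odd u, so j = (r − t) u solves t + j u ≡ r.
affine-inverse : ∀ {u} → u ≡ 1 ⊎ u ≡ 3 → ∀ t → t < 4 → ∀ r → r < 4 →
                 (t + ((r + 4 ∸ t) * u % 4) * u) % 4 ≡ r
affine-inverse (inj₁ refl) = <4-elim (<4-elim refl refl refl refl) (<4-elim refl refl refl refl)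
                                     (<4-elim refl refl refl refl) (<4-elim refl refl refl refl)
affine-inverse (inj₂ refl) = <4-elim (<4-elim refl refl refl refl) (<4-elim refl refl refl refl)
                                     (<4-elim refl refl refl refl) (<4-elim refl refl refl refl)

crt-surjective : ∀ {m} .{{_ : NonZero m}} → m % 2 ≡ 1 → ∀ {x₁ x₂} → x₁ < 4 → x₂ < m →
                 ∃ λ x → x < 4 * m × x % 4 ≡ x₁ × x % m ≡ x₂
crt-surjective {m} odd {x₁} {x₂} x₁<4 x₂<m =
  x₂ + j * m , s+j*m<k*m x₂<m (m%n<n ((x₁ + 4 ∸ x₂ % 4) * (m % 4)) 4) , x%4≡x₁ , [s+jm]%m≡s j x₂<m
  where
  j : ℕ
  j = (x₁ + 4 ∸ x₂ % 4) * (m % 4) % 4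
  x%4≡x₁ : (x₂ + j * m) % 4 ≡ x₁
  x%4≡x₁ = trans ([s+jm]%4 x₂ j m) (affine-inverse (odd⇒%4≡1⊎3 {m} odd) (x₂ % 4) (m%n<n x₂ 4) x₁ x₁<4)

crt-zero : ∀ {m} .{{_ : NonZero m}} → m % 2 ≡ 1 → ∀ {x} → x < 4 * m → x % m ≡ 0 →
           x % 4 ≡ 0 ⊎ x % 4 ≡ 2 → x ≡ 0 ⊎ x ≡ 2 * m
crt-zero {m} odd {x} x<4m x%m≡0 x%4∈02 = Data.Sum.map x≡·m x≡·m j∈02
  where
  open ≡-Reasoning
  j : ℕ
  j = x / m
  x≡j*m : x ≡ j * m
  x≡j*m = trans (m≡m%n+[m/n]*n x m) (cong (_+ j * m) x%m≡0)
  x≡·m : ∀ {k} → j ≡ k → x ≡ k * m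
  x≡·m j≡k = trans x≡j*m (cong (_* m) j≡k)
  x%2≡0 : x % 2 ≡ 0
  x%2≡0 = trans (sym (m∣n⇒o%n%m≡o%m 2 4 x (divides 2 refl))) ([ cong (_% 2) , cong (_% 2) ] x%4∈02)
  j%2≡0 : j % 2 ≡ 0
  j%2≡0 = begin
    j % 2                  ≡⟨ m%n%n≡m%n j 2 ⟨
    j % 2 % 2              ≡⟨ cong (_% 2) (ℕP.*-identityʳ (j % 2)) ⟨
    (j % 2 * 1) % 2        ≡⟨ cong (λ o → (j % 2 * o) % 2) odd ⟨
    (j % 2 * (m % 2)) % 2  ≡⟨ %-distribˡ-* j m 2 ⟨
    (j * m) % 2            ≡⟨ cong (_% 2) x≡j*m ⟨
    x % 2                  ≡⟨ x%2≡0 ⟩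
    0                      ∎
  j∈02 : j ≡ 0 ⊎ j ≡ 2
  j∈02 = <4-elim {P = λ j → j % 2 ≡ 0 → j ≡ 0 ⊎ j ≡ 2}
           (λ _ → inj₁ refl) (λ ()) (λ _ → inj₂ refl) (λ ()) j (m<n*o⇒m/o<n x<4m) j%2≡0

module RangeSum {c ℓ} (M : CommutativeMonoid c ℓ) where

  open CommutativeMonoid M
    renaming (refl to ≈-refl; sym to ≈-sym; trans to ≈-trans; reflexive to ≈-reflexive; setoid to ≈-setoid)
  open CommSemigroupProps commutativeSemigroup using (interchange)
  open import Relation.Binary.Reasoning.Setoid ≈-setoid
  open CommMonoidSolver M using (Expr; var; id; _⊕_; prove)

  Σ : ℕ → (ℕ → Carrier) → Carrier
  Σ zero    f = ε
  Σ (suc n) f = Σ n f ∙ f n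

  Σʳ : ℕ → (ℕ → Carrier) → Carrier
  Σʳ zero    f = ε
  Σʳ (suc n) f = f n ∙ Σʳ n f

  Σʳ≈Σ : ∀ n f → Σʳ n f ≈ Σ n f
  Σʳ≈Σ zero    f = ≈-refl
  Σʳ≈Σ (suc n) f = ≈-trans (∙-congˡ (Σʳ≈Σ n f)) (comm (f n) (Σ n f))

  Σ-cong : ∀ n {f g} → (∀ {i} → i < n → f i ≈ g i) → Σ n f ≈ Σ n g
  Σ-cong zero    f≈g = ≈-refl
  Σ-cong (suc n) f≈g = ∙-cong (Σ-cong n (λ i<n → f≈g (ℕP.m<n⇒m<1+n i<n))) (f≈g (ℕP.n<1+n n))

  Σ-∙ : ∀ n f g → Σ n (λ i → f i ∙ g i) ≈ Σ n f ∙ Σ n g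
  Σ-∙ zero    f g = ≈-sym (identityˡ ε)
  Σ-∙ (suc n) f g = ≈-trans (∙-congʳ (Σ-∙ n f g)) (interchange (Σ n f) (Σ n g) (f n) (g n))

  Σ-+ : ∀ a n f → Σ (a + n) f ≈ Σ a f ∙ Σ n (λ i → f (a + i))
  Σ-+ a zero    f = begin
    Σ (a + 0) f  ≡⟨ cong (λ k → Σ k f) (ℕP.+-identityʳ a) ⟩
    Σ a f        ≈⟨ identityʳ (Σ a f) ⟨
    Σ a f ∙ ε    ∎
  Σ-+ a (suc n) f = begin
    Σ (a + suc n) f                                   ≡⟨ cong (λ k → Σ k f) (ℕP.+-suc a n) ⟩
    Σ (a + n) f ∙ f (a + n)                           ≈⟨ ∙-congʳ (Σ-+ a n f) ⟩
    (Σ a f ∙ Σ n (λ i → f (a + i))) ∙ f (a + n)       ≈⟨ assoc _ _ _ ⟩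
    Σ a f ∙ (Σ n (λ i → f (a + i)) ∙ f (a + n))       ∎

  Σ-blocks : ∀ k m f → Σ (k * m) f ≈ Σ k (λ j → Σ m (λ s → f (s + j * m)))
  Σ-blocks zero    m f = ≈-refl
  Σ-blocks (suc k) m f = begin
    Σ (m + k * m) f
      ≡⟨ cong (λ n → Σ n f) (ℕP.+-comm m (k * m)) ⟩
    Σ (k * m + m) f
      ≈⟨ Σ-+ (k * m) m f ⟩
    Σ (k * m) f ∙ Σ m (λ s → f (k * m + s))
      ≈⟨ ∙-cong (Σ-blocks k m f) (Σ-cong m λ {s} _ → ≈-reflexive (cong f (ℕP.+-comm (k * m) s))) ⟩
    Σ k (λ j → Σ m (λ s → f (s + j * m))) ∙ Σ m (λ s → f (s + k * m))
      ∎

  Σ-swap : ∀ m k (F : ℕ → ℕ → Carrier) → Σ m (λ s → Σ k (F s)) ≈ Σ k (λ j → Σ m (λ s → F s j))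
  Σ-swap m zero    F = Σ-ε m
    where
    Σ-ε : ∀ n → Σ n (λ _ → ε) ≈ ε
    Σ-ε zero    = ≈-refl
    Σ-ε (suc n) = ≈-trans (identityʳ _) (Σ-ε n)
  Σ-swap m (suc k) F = begin
    Σ m (λ s → Σ k (F s) ∙ F s k)                        ≈⟨ Σ-∙ m _ _ ⟩
    Σ m (λ s → Σ k (F s)) ∙ Σ m (λ s → F s k)            ≈⟨ ∙-congʳ (Σ-swap m k F) ⟩
    Σ k (λ j → Σ m (λ s → F s j)) ∙ Σ m (λ s → F s k)    ∎

  private
    Σ₄-expr : Fin 4 → Fin 4 → Fin 4 → Fin 4 → Expr 4
    Σ₄-expr i j k l = (((id ⊕ var i) ⊕ var j) ⊕ var k) ⊕ var l

    Σ₄-sorted : Expr 4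
    Σ₄-sorted = Σ₄-expr (# 0) (# 1) (# 2) (# 3)

    Σ₄-env : (ℕ → Carrier) → Vec Carrier 4
    Σ₄-env g = g 0 ∷ g 1 ∷ g 2 ∷ g 3 ∷ []

    Σ₄-affine-at : ℕ → ℕ → Set (c ⊔ ℓ)
    Σ₄-affine-at u t = (g : ℕ → Carrier) → Σ 4 (λ j → g ((t + j * u) % 4)) ≈ Σ 4 g

  Σ₄-affine : ∀ {u} → u ≡ 1 ⊎ u ≡ 3 → ∀ t → t < 4 → (g : ℕ → Carrier) →
              Σ 4 (λ j → g ((t + j * u) % 4)) ≈ Σ 4 g
  Σ₄-affine (inj₁ refl) = <4-elim {P = Σ₄-affine-at 1}
    (λ g → prove 4 (Σ₄-expr (# 0) (# 1) (# 2) (# 3)) Σ₄-sorted (Σ₄-env g))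
    (λ g → prove 4 (Σ₄-expr (# 1) (# 2) (# 3) (# 0)) Σ₄-sorted (Σ₄-env g))
    (λ g → prove 4 (Σ₄-expr (# 2) (# 3) (# 0) (# 1)) Σ₄-sorted (Σ₄-env g))
    (λ g → prove 4 (Σ₄-expr (# 3) (# 0) (# 1) (# 2)) Σ₄-sorted (Σ₄-env g))
  Σ₄-affine (inj₂ refl) = <4-elim {P = Σ₄-affine-at 3}
    (λ g → prove 4 (Σ₄-expr (# 0) (# 3) (# 2) (# 1)) Σ₄-sorted (Σ₄-env g))
    (λ g → prove 4 (Σ₄-expr (# 1) (# 0) (# 3) (# 2)) Σ₄-sorted (Σ₄-env g))
    (λ g → prove 4 (Σ₄-expr (# 2) (# 1) (# 0) (# 3)) Σ₄-sorted (Σ₄-env g))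
    (λ g → prove 4 (Σ₄-expr (# 3) (# 2) (# 1) (# 0)) Σ₄-sorted (Σ₄-env g))

  Σ-crt : ∀ {m} .{{_ : NonZero m}} → m % 2 ≡ 1 → (F : ℕ → ℕ → Carrier) →
          Σ (4 * m) (λ x → F (x % 4) (x % m)) ≈ Σ 4 (λ r → Σ m (F r))
  Σ-crt {m} odd F = begin
    Σ (4 * m) (λ x → F (x % 4) (x % m))
      ≈⟨ Σ-blocks 4 m _ ⟩
    Σ 4 (λ j → Σ m (λ s → F ((s + j * m) % 4) ((s + j * m) % m)))
      ≈⟨ Σ-cong 4 (λ {j} _ → Σ-cong m λ {s} s<m →
           ≈-reflexive (cong (F ((s + j * m) % 4)) ([s+jm]%m≡s j s<m))) ⟩
    Σ 4 (λ j → Σ m (λ s → F ((s + j * m) % 4) s))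
      ≈⟨ Σ-swap m 4 (λ s j → F ((s + j * m) % 4) s) ⟨
    Σ m (λ s → Σ 4 (λ j → F ((s + j * m) % 4) s))
      ≈⟨ Σ-cong m (λ {s} _ →
           ≈-trans (Σ-cong 4 λ {j} _ → ≈-reflexive (cong (λ r → F r s) ([s+jm]%4 s j m)))
                   (Σ₄-affine (odd⇒%4≡1⊎3 {m} odd) (s % 4) (m%n<n s 4) (λ r → F r s))) ⟩
    Σ m (λ s → Σ 4 (λ r → F r s))
      ≈⟨ Σ-swap m 4 (λ s r → F r s) ⟩
    Σ 4 (λ r → Σ m (F r))
      ∎

module ℤΣ = RangeSum ℤP.+-0-commutativeMonoid
module ℕΣ = RangeSum ℕP.+-0-commutativeMonoid

Σ<≡Σ : ∀ n f → Σ< n f ≡ ℤΣ.Σ n f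
Σ<≡Σ zero    f = refl
Σ<≡Σ (suc n) f = cong (ℤ._+ f n) (Σ<≡Σ n f)

count<≡Σ : ∀ n p → count< n p ≡ ℕΣ.Σ n (λ i → if p i then 1 else 0)
count<≡Σ zero    p = refl
count<≡Σ (suc n) p = trans (cong ((if p n then 1 else 0) +_) (count<≡Σ n p)) (ℕP.+-comm (if p n then 1 else 0) _)

sgn-opposite : ∀ σ → sgn (Sign.opposite σ) ≡ ℤ.- sgn σ
sgn-opposite Sign.+ = refl
sgn-opposite Sign.- = refl

atS-mod : ∀ {n} .{{_ : NonZero n}} (f : Fin n → Sign) i → atS f i ≡ f (i mod n)
atS-mod {suc n} f i = refl

modN-% : ∀ x n .{{_ : NonZero n}} → modN x n ≡ x % n
modN-% x (suc n) = refl

expansionSign : ℕ → Sign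
expansionSign 0 = Sign.+
expansionSign 1 = Sign.+
expansionSign _ = Sign.-

seqExp-lower : ∀ {m} (φ : Fin (2 * m) → Sign) {y} → y < 2 * m → seqExp m φ y ≡ sgn (atS φ y)
seqExp-lower {m} φ {y} y<2m with y <ᵇ 2 * m | ℕP.<⇒<ᵇ y<2m
... | true | _ = refl

seqExp-upper : ∀ {m} (φ : Fin (2 * m) → Sign) {y} → 2 * m ≤ y →
               seqExp m φ y ≡ ℤ.- sgn (atS φ (y ∸ 2 * m))
seqExp-upper {m} φ {y} 2m≤y with y <ᵇ 2 * m in y<ᵇ2m
... | false = refl
... | true  = ⊥-elim (ℕP.<⇒≱ (ℕP.<ᵇ⇒< y (2 * m) (subst T (sym y<ᵇ2m) tt)) 2m≤y)

seqExp-quarter : ∀ {m} (φ : Fin (2 * m) → Sign) {s} j → s < m → j < 4 →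
                 seqExp m φ (s + j * m) ≡ sgn (expansionSign j Sign.* atS φ (s + (j % 2) * m))
seqExp-quarter {m} φ 0 s<m _ = seqExp-lower {m} φ (s+j*m<k*m {k = 2} s<m (s≤s z≤n))
seqExp-quarter {m} φ 1 s<m _ = seqExp-lower {m} φ (s+j*m<k*m {k = 2} s<m (s≤s (s≤s z≤n)))
seqExp-quarter {m} φ {s} 2 s<m _ = begin
  seqExp m φ (s + 2 * m)
    ≡⟨ seqExp-upper {m} φ (ℕP.m≤n+m (2 * m) s) ⟩
  ℤ.- sgn (atS φ (s + 2 * m ∸ 2 * m))
    ≡⟨ cong (λ i → ℤ.- sgn (atS φ i)) (trans (ℕP.m+n∸n≡m s (2 * m)) (sym (ℕP.+-identityʳ s))) ⟩
  ℤ.- sgn (atS φ (s + 0))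
    ≡⟨ sgn-opposite _ ⟨
  sgn (Sign.opposite (atS φ (s + 0)))
    ∎
  where open ≡-Reasoning
seqExp-quarter {m} φ {s} 3 s<m _ = begin
  seqExp m φ (s + 3 * m)
    ≡⟨ seqExp-upper {m} φ (ℕP.≤-trans (ℕP.m≤n+m (2 * m) m) (ℕP.m≤n+m _ s)) ⟩
  ℤ.- sgn (atS φ (s + 3 * m ∸ 2 * m))
    ≡⟨ cong (λ i → ℤ.- sgn (atS φ (i ∸ 2 * m))) s+3m ⟩
  ℤ.- sgn (atS φ (s + 1 * m + 2 * m ∸ 2 * m))
    ≡⟨ cong (λ i → ℤ.- sgn (atS φ i)) (ℕP.m+n∸n≡m (s + 1 * m) (2 * m)) ⟩
  ℤ.- sgn (atS φ (s + 1 * m))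
    ≡⟨ sgn-opposite _ ⟨
  sgn (Sign.opposite (atS φ (s + 1 * m)))
    ∎
  where
  open ≡-Reasoning
  s+3m : s + 3 * m ≡ s + 1 * m + 2 * m
  s+3m = trans (cong (s +_) (ℕP.*-distribʳ-+ m 1 2)) (sym (ℕP.+-assoc s (1 * m) (2 * m)))
seqExp-quarter φ (suc (suc (suc (suc _)))) _ (s≤s (s≤s (s≤s (s≤s ()))))

arrExp-row : ∀ {m} (ψ : Fin 2 → Fin m → Sign) a k → a < 4 →
             arrExp m ψ a k ≡ sgn (expansionSign a Sign.* atS (ψ (a mod 2)) k)
arrExp-row ψ 0 k _ = refl
arrExp-row ψ 1 k _ = refl
arrExp-row ψ 2 k _ = sym (sgn-opposite _)
arrExp-row ψ 3 k _ = sym (sgn-opposite _)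
arrExp-row ψ (suc (suc (suc (suc _)))) k (s≤s (s≤s (s≤s (s≤s ()))))

constructSign : Bool → ℕ → ℕ → Sign
constructSign true  0 a = Sign.+
constructSign true  1 a = neg1^ (1 ∸ a)
constructSign true  2 a = Sign.-
constructSign true  _ a = neg1^ a
constructSign false 0 a = neg1^ a
constructSign false 1 a = Sign.+
constructSign false 2 a = neg1^ (1 ∸ a)
constructSign false _ a = Sign.-

constructShift : ℕ → ℕ → ℕ
constructShift 0 a = a
constructShift 1 a = 1 ∸ a
constructShift 2 a = a
constructShift _ a = 1 ∸ a

construct-normal : ∀ m (φ : Fin (2 * m) → Sign) a k →
  construct m φ a k ≡
  constructSign (m % 4 ≡ᵇ 1) (toℕ k % 4) (toℕ a) Sign.*
    atS φ (toℕ k + constructShift (toℕ k % 4) (toℕ a) * m)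
construct-normal m φ a k with m % 4 ≡ᵇ 1 | toℕ k % 4
... | true  | 0 = refl
... | true  | 1 = refl
... | true  | 2 = refl
... | true  | suc (suc (suc _)) = refl
... | false | 0 = refl
... | false | 1 = refl
... | false | 2 = refl
... | false | suc (suc (suc _)) = refl

-- The paper's case table: with t = s mod 4, u = m mod 4 and a = (s + j m) mod 4,
-- the entry ϕ'(a, s) has the same sign and the same index into φ as φ'(s + j m).
ConstructMatchesExpansion : ℕ → ℕ → ℕ → Set
ConstructMatchesExpansion u t j =
  (expansionSign a Sign.* constructSign (u ≡ᵇ 1) t (a % 2) , constructShift t (a % 2))
    ≡ (expansionSign j , j % 2)
  where
  a : ℕ
  a = (t + j * u) % 4

construct-matches-expansion : ∀ {u} → u ≡ 1 ⊎ u ≡ 3 → ∀ t → t < 4 → ∀ j → j < 4 →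
                              ConstructMatchesExpansion u t j
construct-matches-expansion (inj₁ refl) =
  <4-elim (<4-elim refl refl refl refl) (<4-elim refl refl refl refl)
          (<4-elim refl refl refl refl) (<4-elim refl refl refl refl)
construct-matches-expansion (inj₂ refl) =
  <4-elim (<4-elim refl refl refl refl) (<4-elim refl refl refl refl)
          (<4-elim refl refl refl refl) (<4-elim refl refl refl refl)

module Correspondence {m : ℕ} .{{_ : NonZero m}} (odd : m % 2 ≡ 1) (φ : Fin (2 * m) → Sign) where

  private
    instance
      4m-nonZero : NonZero (4 * m)
      4m-nonZero = ℕP.m*n≢0 4 m

  ψ : Fin 2 → Fin m → Sign
  ψ = construct m φ

  arrExp-construct : ∀ {a k} → a < 4 → k < m →
    arrExp m ψ a k ≡
    sgn (expansionSign a Sign.*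
         (constructSign (m % 4 ≡ᵇ 1) (k % 4) (a % 2) Sign.* atS φ (k + constructShift (k % 4) (a % 2) * m)))
  arrExp-construct {a} {k} a<4 k<m = begin
    arrExp m ψ a k
      ≡⟨ arrExp-row ψ a k a<4 ⟩
    sgn (expansionSign a Sign.* atS (ψ (a mod 2)) k)
      ≡⟨ cong (λ σ → sgn (expansionSign a Sign.* σ))
              (trans (atS-mod (ψ (a mod 2)) k) (construct-normal m φ (a mod 2) (k mod m))) ⟩
    sgn (expansionSign a Sign.* (constructSign b (toℕ (k mod m) % 4) (toℕ (a mod 2)) Sign.*
      atS φ (toℕ (k mod m) + constructShift (toℕ (k mod m) % 4) (toℕ (a mod 2)) * m)))
      ≡⟨ cong₂ (λ k′ a′ → sgn (expansionSign a Sign.*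
                                (constructSign b (k′ % 4) a′ Sign.* atS φ (k′ + constructShift (k′ % 4) a′ * m))))
               (trans (FinP.toℕ-fromℕ< _) (m<n⇒m%n≡m k<m)) (FinP.toℕ-fromℕ< _) ⟩
    sgn (expansionSign a Sign.* (constructSign b (k % 4) (a % 2) Sign.* atS φ (k + constructShift (k % 4) (a % 2) * m)))
      ∎
    where
    open ≡-Reasoning
    b : Bool
    b = m % 4 ≡ᵇ 1

  seqExp≡arrExp : ∀ {y} → y < 4 * m → seqExp m φ y ≡ arrExp m ψ (y % 4) (y % m)
  seqExp≡arrExp {y} y<4m = begin
    seqExp m φ y
      ≡⟨ cong (seqExp m φ) (m≡m%n+[m/n]*n y m) ⟩
    seqExp m φ (s + j * m)
      ≡⟨ seqExp-quarter {m} φ j s<m j<4 ⟩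
    sgn (expansionSign j Sign.* atS φ (s + (j % 2) * m))
      ≡⟨ cong₂ (λ σ c → sgn (σ Sign.* atS φ (s + c * m))) (cong proj₁ matches) (cong proj₂ matches) ⟨
    sgn ((expansionSign a Sign.* constructSign b t (a % 2)) Sign.* atS φ (s + constructShift t (a % 2) * m))
      ≡⟨ cong sgn (SignP.*-assoc (expansionSign a) _ _) ⟩
    sgn (expansionSign a Sign.* (constructSign b t (a % 2) Sign.* atS φ (s + constructShift t (a % 2) * m)))
      ≡⟨ arrExp-construct (m%n<n (t + j * (m % 4)) 4) s<m ⟨
    arrExp m ψ a s
      ≡⟨ cong (λ r → arrExp m ψ r s) y%4≡a ⟨
    arrExp m ψ (y % 4) s
      ∎
    where
    open ≡-Reasoning
    s j t a : ℕ
    s = y % m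
    j = y / m
    t = s % 4
    a = (t + j * (m % 4)) % 4
    b : Bool
    b = m % 4 ≡ᵇ 1
    s<m : s < m
    s<m = m%n<n y m
    j<4 : j < 4
    j<4 = m<n*o⇒m/o<n y<4m
    matches : ConstructMatchesExpansion (m % 4) t j
    matches = construct-matches-expansion (odd⇒%4≡1⊎3 {m} odd) t (m%n<n s 4) j j<4
    y%4≡a : y % 4 ≡ a
    y%4≡a = trans (cong (_% 4) (m≡m%n+[m/n]*n y m)) ([s+jm]%4 s j m)

  seqAC≡arrAC : ∀ x → seqAC m φ x ≡ arrAC m ψ (x % 4) (x % m)
  seqAC≡arrAC x = begin
    seqAC m φ x
      ≡⟨ Σ<≡Σ (4 * m) _ ⟩
    ℤΣ.Σ (4 * m) (λ b → seqExp m φ b ℤ.* seqExp m φ (modN (x + b) (4 * m)))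
      ≡⟨ ℤΣ.Σ-cong (4 * m) (λ {b} b<4m → cong₂ ℤ._*_ (seqExp≡arrExp b<4m) (shifted b)) ⟩
    ℤΣ.Σ (4 * m) (λ b → F (b % 4) (b % m))
      ≡⟨ ℤΣ.Σ-crt odd F ⟩
    ℤΣ.Σ 4 (λ r → ℤΣ.Σ m (F r))
      ≡⟨ trans (Σ<≡Σ 4 (λ r → Σ< m (F r))) (ℤΣ.Σ-cong 4 λ {r} _ → Σ<≡Σ m (F r)) ⟨
    arrAC m ψ (x % 4) (x % m)
      ∎
    where
    open ≡-Reasoning
    F : ℕ → ℕ → ℤ
    F r s = arrExp m ψ r s ℤ.* arrExp m ψ ((x % 4 + r) % 4) (modN (x % m + s) m)
    shifted : ∀ b → seqExp m φ (modN (x + b) (4 * m)) ≡ arrExp m ψ ((x % 4 + b % 4) % 4) (modN (x % m + b % m) m)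
    shifted b = begin
      seqExp m φ (modN (x + b) (4 * m))
        ≡⟨ cong (seqExp m φ) (modN-% (x + b) (4 * m)) ⟩
      seqExp m φ ((x + b) % (4 * m))
        ≡⟨ seqExp≡arrExp (m%n<n (x + b) (4 * m)) ⟩
      arrExp m ψ ((x + b) % (4 * m) % 4) ((x + b) % (4 * m) % m)
        ≡⟨ cong₂ (arrExp m ψ) (m∣n⇒o%n%m≡o%m 4 (4 * m) (x + b) (divides m (ℕP.*-comm 4 m)))
                              (m∣n⇒o%n%m≡o%m m (4 * m) (x + b) (divides 4 refl)) ⟩
      arrExp m ψ ((x + b) % 4) ((x + b) % m)
        ≡⟨ cong₂ (arrExp m ψ) (%-distribˡ-+ x b 4) (trans (%-distribˡ-+ x b m) (sym (modN-% _ m))) ⟩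
      arrExp m ψ ((x % 4 + b % 4) % 4) (modN (x % m + b % m) m)
        ∎

  -- Σʳ 4 unfolds to exactly the zero count appearing in IsGOBA-10.
  zeroCounts : count< (4 * m) (λ x → isZero (seqAC m φ x)) ≡
               ℕΣ.Σʳ 4 (λ r → count< m (λ s → isZero (arrAC m ψ r s)))
  zeroCounts = begin
    count< (4 * m) (λ x → isZero (seqAC m φ x))
      ≡⟨ count<≡Σ (4 * m) _ ⟩
    ℕΣ.Σ (4 * m) (λ x → if isZero (seqAC m φ x) then 1 else 0)
      ≡⟨ ℕΣ.Σ-cong (4 * m) (λ {x} _ → cong (λ r → if isZero r then 1 else 0) (seqAC≡arrAC x)) ⟩
    ℕΣ.Σ (4 * m) (λ x → Z (x % 4) (x % m))
      ≡⟨ ℕΣ.Σ-crt odd Z ⟩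
    ℕΣ.Σ 4 (λ r → ℕΣ.Σ m (Z r))
      ≡⟨ ℕΣ.Σ-cong 4 (λ {r} _ → count<≡Σ m (λ s → isZero (arrAC m ψ r s))) ⟨
    ℕΣ.Σ 4 (λ r → count< m (λ s → isZero (arrAC m ψ r s)))
      ≡⟨ ℕΣ.Σʳ≈Σ 4 (λ r → count< m (λ s → isZero (arrAC m ψ r s))) ⟨
    ℕΣ.Σʳ 4 (λ r → count< m (λ s → isZero (arrAC m ψ r s)))
      ∎
    where
    open ≡-Reasoning
    Z : ℕ → ℕ → ℕ
    Z r s = if isZero (arrAC m ψ r s) then 1 else 0

  GOBS⇒GOBA : IsGOBS m φ → IsGOBA-10 m ψ
  GOBS⇒GOBA (inRange , count) = inRange′ , trans (sym zeroCounts) count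
    where
    inRange′ : ∀ x₁ x₂ → x₁ < 4 → x₂ < m → ¬ ((x₁ ≡ 0 ⊎ x₁ ≡ 2) × x₂ ≡ 0) →
               In0±4 (arrAC m ψ x₁ x₂)
    inRange′ x₁ x₂ x₁<4 x₂<m notExcluded with crt-surjective odd x₁<4 x₂<m
    ... | x , x<4m , refl , refl = subst In0±4 (seqAC≡arrAC x) (inRange x x<4m x≢0 x≢2m)
      where
      x≢0 : x ≢ 0
      x≢0 refl = notExcluded (inj₁ refl , m*n%n≡0 0 m)
      x≢2m : x ≢ 2 * m
      x≢2m refl = notExcluded (inj₂ ([2m]%4≡2 {m} odd) , m*n%n≡0 2 m)

  GOBA⇒GOBS : IsGOBA-10 m ψ → IsGOBS m φ
  GOBA⇒GOBS (inRange , count) = inRange′ , trans zeroCounts count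
    where
    inRange′ : ∀ x → x < 4 * m → x ≢ 0 → x ≢ 2 * m → In0±4 (seqAC m φ x)
    inRange′ x x<4m x≢0 x≢2m =
      subst In0±4 (sym (seqAC≡arrAC x)) (inRange (x % 4) (x % m) (m%n<n x 4) (m%n<n x m) notExcluded)
      where
      notExcluded : ¬ ((x % 4 ≡ 0 ⊎ x % 4 ≡ 2) × x % m ≡ 0)
      notExcluded (x%4∈02 , x%m≡0) = [ x≢0 , x≢2m ] (crt-zero odd x<4m x%m≡0 x%4∈02)

lemma1 : (m : ℕ) → 1 < m → m % 2 ≡ 1 → (φ : Fin (2 * m) → Sign)
         → IsGOBS m φ ⇔ IsGOBA-10 m (construct m φ)
lemma1 zero      _ ()
lemma1 m@(suc _) _ odd φ = mk⇔ GOBS⇒GOBA GOBA⇒GOBS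
  where open Correspondence odd φ
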